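{- If $G$ is a connected graph such that $\mathcal{C}_G$ has $k$ equivalence classes, then $G$ has exactly $2^k$ quasi-transitive $2$-edge-colourings.
   Context: A quasi-transitive $2$-edge-colouring of a graph $G$ is a map $c: E(G)\to\{R,B\}$ such that for all pairs of edges $xy, yz \in E(G)$ with $c(xy)\neq c(yz)$, we have $xz\in E(G)$. $\mathcal{C}_G$ is the equivalence relation on $E(G)$ with $e\sim f$ iff $c(e)=c(f)$ for every quasi-transitive $2$-edge-colouring $c$ of $G$. -}

module Defs where

open import Data.Nat using (ℕ; suc)
open import Data.Bool using (Bool; T; T?)
open import Data.Fin using (Fin; toℕ)
open import Data.Fin.Properties using ()
open import Data.Nat.Properties using (_<?_)
open import Data.List using (List; []; _∷_; length; filter; cartesianProduct; lookup)
open import Data.List.Base using (allFin)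
open import Data.Product using (Σ; ∃; _×_; _,_; proj₁; proj₂)
open import Data.Sum using (_⊎_)
open import Data.Vec using (Vec)
import Data.Vec as Vec
open import Relation.Nullary using (¬_)
open import Relation.Nullary.Decidable using (_×-dec_)
open import Relation.Binary.PropositionalEquality using (_≡_; _≢_)

record Graph (n : ℕ) : Set where
  field
    adj   : Fin n → Fin n → Bool
    sym   : ∀ x y → adj x y ≡ adj y x
    irrefl : ∀ x → adj x x ≡ Data.Bool.false

open Graph public

Adj : ∀ {n} → Graph n → Fin n → Fin n → Set
Adj G x y = T (adj G x y)

data Walk {n} (G : Graph n) : Fin n → Fin n → Set where
  here : ∀ {x} → Walk G x x
  step : ∀ {x y z} → Adj G x y → Walk G y z → Walk G x z

Connected : ∀ {n} → Graph n → Set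
Connected {n} G = ∀ (x y : Fin n) → Walk G x y

-- The edge set E(G), enumerated as the list of pairs (i , j) with i < j
-- and i adjacent to j (each unordered edge appears exactly once).
edgeList : ∀ {n} → Graph n → List (Fin n × Fin n)
edgeList {n} G =
  filter (λ p → (toℕ (proj₁ p) <? toℕ (proj₂ p)) ×-dec T? (adj G (proj₁ p) (proj₂ p)))
         (cartesianProduct (allFin n) (allFin n))

∣E∣ : ∀ {n} → Graph n → ℕ
∣E∣ G = length (edgeList G)

Edge : ∀ {n} → Graph n → Set
Edge G = Fin (∣E∣ G)

Joins : ∀ {n} (G : Graph n) → Edge G → Fin n → Fin n → Set
Joins G e x y = lookup (edgeList G) e ≡ (x , y) ⊎ lookup (edgeList G) e ≡ (y , x)

data Colour : Set where
  R B : Colour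

Colouring : ∀ {n} → Graph n → Set
Colouring G = Vec Colour (∣E∣ G)

colour : ∀ {n} {G : Graph n} → Colouring G → Edge G → Colour
colour c e = Vec.lookup c e

QuasiTransitive : ∀ {n} (G : Graph n) → Colouring G → Set
QuasiTransitive {n} G c =
  ∀ (e f : Edge G) (x y z : Fin n) →
    Joins G e x y → Joins G f y z → colour {G = G} c e ≢ colour {G = G} c f → Adj G x z

𝒞 : ∀ {n} (G : Graph n) → Edge G → Edge G → Set
𝒞 G e f = ∀ (c : Colouring G) → QuasiTransitive G c → colour {G = G} c e ≡ colour {G = G} c f

-- 𝒞_G has exactly k equivalence classes: there is a surjective map
-- cls : E(G) → Fin k whose fibres are exactly the 𝒞_G-classes.
HasClasses : ∀ {n} (G : Graph n) → ℕ → Set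
HasClasses G k =
  Σ (Edge G → Fin k) λ cls →
    (∀ (i : Fin k) → ∃ λ e → cls e ≡ i) ×
    (∀ e f → (𝒞 G e f → cls e ≡ cls f) × (cls e ≡ cls f → 𝒞 G e f))

-- A colouring is quasi-transitive exactly when it is constant on the classes
-- of 𝒞_G: one direction is the definition of 𝒞_G, and conversely, if edges
-- xy and yz of different colours had xz ∉ E(G), then no quasi-transitive
-- colouring could separate them, so they would lie in one class of 𝒞_G.
-- Hence the quasi-transitive colourings are exactly the colourings of the
-- k classes pulled back along the class map, and there are 2^k of them.
module Submission where

open import Defs hiding (sym)
open import Data.Nat using (ℕ; zero; suc; _+_; _*_; _^_)
open import Data.Bool using (T?)
open import Data.Fin using (Fin)
open import Data.List using (List; []; _∷_; _++_; length; map; cartesianProductWith)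
open import Data.List.Properties using (length-++; length-map)
open import Data.List.Membership.Propositional using (_∈_)
open import Data.List.Membership.Propositional.Properties
  using (∈-map⁺; ∈-map⁻; ∈-cartesianProductWith⁺)
open import Data.List.Relation.Unary.Any using (here; there)
open import Data.List.Relation.Unary.All using ([]; _∷_)
open import Data.List.Relation.Unary.AllPairs using ([]; _∷_)
open import Data.List.Relation.Unary.Unique.Propositional using (Unique)
open import Data.List.Relation.Unary.Unique.Propositional.Properties
  using (map⁺; cartesianProductWith⁺)
open import Data.Vec using (Vec; lookup; tabulate) renaming ([] to []ᵛ; _∷_ to _∷ᵛ_)
open import Data.Vec.Properties using (∷-injective; lookup∘tabulate; tabulate∘lookup; tabulate-cong)
open import Data.Product using (Σ; ∃; _×_; _,_; proj₁; proj₂)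
open import Relation.Nullary using (Dec; yes; no)
open import Relation.Nullary.Decidable using (decidable-stable)
open import Relation.Binary.PropositionalEquality
  using (_≡_; refl; sym; trans; cong; cong₂; module ≡-Reasoning)

private
  variable
    X Y Z : Set
    m k : ℕ

length-cartesianProductWith : (f : X → Y → Z) (xs : List X) (ys : List Y) →
  length (cartesianProductWith f xs ys) ≡ length xs * length ys
length-cartesianProductWith f []       ys = refl
length-cartesianProductWith f (x ∷ xs) ys = begin
  length (map (f x) ys ++ cartesianProductWith f xs ys)  ≡⟨ length-++ (map (f x) ys) ⟩
  length (map (f x) ys) + length (cartesianProductWith f xs ys)
    ≡⟨ cong₂ _+_ (length-map (f x) ys) (length-cartesianProductWith f xs ys) ⟩
  length ys + length xs * length ys                      ∎
  where open ≡-Reasoning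

vectors : List X → (k : ℕ) → List (Vec X k)
vectors xs zero    = []ᵛ ∷ []
vectors xs (suc k) = cartesianProductWith _∷ᵛ_ xs (vectors xs k)

length-vectors : (xs : List X) (k : ℕ) → length (vectors xs k) ≡ length xs ^ k
length-vectors xs zero    = refl
length-vectors xs (suc k) = trans (length-cartesianProductWith _∷ᵛ_ xs (vectors xs k))
                                  (cong (length xs *_) (length-vectors xs k))

vectors⁺ : {xs : List X} → Unique xs → (k : ℕ) → Unique (vectors xs k)
vectors⁺ xs! zero    = [] ∷ []
vectors⁺ xs! (suc k) = cartesianProductWith⁺ _∷ᵛ_ ∷-injective xs! (vectors⁺ xs! k)

∈-vectors : {xs : List X} → (∀ x → x ∈ xs) → (v : Vec X k) → v ∈ vectors xs k
∈-vectors all∈ []ᵛ       = here refl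
∈-vectors all∈ (x ∷ᵛ v) = ∈-cartesianProductWith⁺ _∷ᵛ_ (all∈ x) (∈-vectors all∈ v)

lookup-ext : {v w : Vec X m} → (∀ i → lookup v i ≡ lookup w i) → v ≡ w
lookup-ext {v = v} {w} v≗w = trans (sym (tabulate∘lookup v))
                                   (trans (tabulate-cong v≗w) (tabulate∘lookup w))

module _ {X : Set} {m k : ℕ} (cls : Fin m → Fin k) where

  pullback : Vec X k → Vec X m
  pullback v = tabulate (λ e → lookup v (cls e))

  lookup-pullback : (v : Vec X k) (e : Fin m) → lookup (pullback v) e ≡ lookup v (cls e)
  lookup-pullback v = lookup∘tabulate (λ e → lookup v (cls e))

  pullback-injective : (∀ i → ∃ λ e → cls e ≡ i) → {v w : Vec X k} → pullback v ≡ pullback w → v ≡ w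
  pullback-injective surj {v} {w} v≡w = lookup-ext λ i →
    let (e , cls-e≡i) = surj i in begin
      lookup v i             ≡⟨ cong (lookup v) (sym cls-e≡i) ⟩
      lookup v (cls e)       ≡⟨ sym (lookup-pullback v e) ⟩
      lookup (pullback v) e  ≡⟨ cong (λ u → lookup u e) v≡w ⟩
      lookup (pullback w) e  ≡⟨ lookup-pullback w e ⟩
      lookup w (cls e)       ≡⟨ cong (lookup w) cls-e≡i ⟩
      lookup w i             ∎
    where open ≡-Reasoning

  pullback-constant : (v : Vec X k) → ∀ e f → cls e ≡ cls f →
                      lookup (pullback v) e ≡ lookup (pullback v) f
  pullback-constant v e f cls-e≡cls-f = begin
    lookup (pullback v) e  ≡⟨ lookup-pullback v e ⟩
    lookup v (cls e)       ≡⟨ cong (lookup v) cls-e≡cls-f ⟩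
    lookup v (cls f)       ≡⟨ lookup-pullback v f ⟨
    lookup (pullback v) f  ∎
    where open ≡-Reasoning

  constant⇒pullback : (∀ i → ∃ λ e → cls e ≡ i) → (c : Vec X m) →
                      (∀ e f → cls e ≡ cls f → lookup c e ≡ lookup c f) →
                      ∃ λ v → pullback v ≡ c
  constant⇒pullback surj c c-constant = v , lookup-ext λ e → begin
    lookup (pullback v) e            ≡⟨ lookup-pullback v e ⟩
    lookup v (cls e)                 ≡⟨ lookup∘tabulate _ (cls e) ⟩
    lookup c (proj₁ (surj (cls e)))  ≡⟨ c-constant _ e (proj₂ (surj (cls e))) ⟩
    lookup c e                       ∎
    where
    open ≡-Reasoning
    v : Vec X k
    v = tabulate (λ i → lookup c (proj₁ (surj i)))

_≟ᶜ_ : (a b : Colour) → Dec (a ≡ b)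
R ≟ᶜ R = yes refl
R ≟ᶜ B = no λ ()
B ≟ᶜ R = no λ ()
B ≟ᶜ B = yes refl

colours : List Colour
colours = R ∷ B ∷ []

colours! : Unique colours
colours! = ((λ ()) ∷ []) ∷ [] ∷ []

∈-colours : ∀ a → a ∈ colours
∈-colours R = here refl
∈-colours B = there (here refl)

Respects𝒞 : ∀ {n} (G : Graph n) → Colouring G → Set
Respects𝒞 G c = ∀ e f → 𝒞 G e f → colour {G = G} c e ≡ colour {G = G} c f

module _ {n} (G : Graph n) where

  quasiTransitive⇒respects𝒞 : ∀ c → QuasiTransitive G c → Respects𝒞 G c
  quasiTransitive⇒respects𝒞 c qt e f e𝒞f = e𝒞f c qt

  respects𝒞⇒quasiTransitive : ∀ c → Respects𝒞 G c → QuasiTransitive G c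
  respects𝒞⇒quasiTransitive c resp e f x y z xy yz c-e≢c-f =
    decidable-stable (T? (adj G x z)) λ ¬xz →
      c-e≢c-f (resp e f λ c′ qt′ →
        decidable-stable (colour {G = G} c′ e ≟ᶜ colour {G = G} c′ f) λ c′-e≢c′-f →
          ¬xz (qt′ e f x y z xy yz c′-e≢c′-f))

  module _ {k} (cls : Edge G → Fin k)
           (classes : ∀ e f → (𝒞 G e f → cls e ≡ cls f) × (cls e ≡ cls f → 𝒞 G e f))
           where

    pullback-quasiTransitive : (v : Vec Colour k) → QuasiTransitive G (pullback cls v)
    pullback-quasiTransitive v = respects𝒞⇒quasiTransitive (pullback cls v) λ e f e𝒞f →
      pullback-constant cls v e f (proj₁ (classes e f) e𝒞f)

    quasiTransitive⇒pullback : (∀ i → ∃ λ e → cls e ≡ i) → ∀ c → QuasiTransitive G c →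
                               ∃ λ v → pullback cls v ≡ c
    quasiTransitive⇒pullback surj c qt = constant⇒pullback cls surj c λ e f same →
      quasiTransitive⇒respects𝒞 c qt e f (proj₂ (classes e f) same)

corollary9 : ∀ {n} (G : Graph n) (k : ℕ) → Connected G → HasClasses G k →
    Σ (List (Colouring G)) (λ L → Unique L × length L ≡ 2 ^ k ×
      (∀ (c : Colouring G) → (QuasiTransitive G c → c ∈ L) × (c ∈ L → QuasiTransitive G c)))
corollary9 G k _ (cls , surj , classes) =
  L , map⁺ (pullback-injective cls surj) (vectors⁺ colours! k) ,
  trans (length-map (pullback cls) (vectors colours k)) (length-vectors colours k) ,
  λ c → qt⇒∈ , ∈⇒qt
  where
  L : List (Colouring G)
  L = map (pullback cls) (vectors colours k)

  qt⇒∈ : ∀ {c} → QuasiTransitive G c → c ∈ L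
  qt⇒∈ {c} qt with v , refl ← quasiTransitive⇒pullback G cls classes surj c qt
    = ∈-map⁺ (pullback cls) (∈-vectors ∈-colours v)

  ∈⇒qt : ∀ {c} → c ∈ L → QuasiTransitive G c
  ∈⇒qt c∈L with v , _ , refl ← ∈-map⁻ (pullback cls) c∈L
    = pullback-quasiTransitive G cls classes v
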